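{- For all integers $n\geq1$ and $m\geq 0$, $\mathrm{diam}(Y_{n,m})=\mathrm{ecc}_{Z_{n,m}}(0)$.
   Context: For integers $n\geq 1$, $m\geq 0$, the Yoke graph $Y_{n,m}$ is the simple graph whose vertices are the tuples $v=(v_0,\dots,v_{m+1})$ with $v_0,v_{m+1}\in\mathbb{Z}_n$, $v_1,\dots,v_m\in\{0,1\}$, and $\sum_{i=0}^{m+1}v_i\equiv 0 \pmod n$. The dYoke graph $Z_{n,m}$ is defined identically except that $v_1,\dots,v_m\in\{ -1,0,1\}$. In both graphs, two vertices $u,v$ are adjacent iff there is $0\leq i\leq m$ such that $u_j=v_j$ for all $j\notin\{i,i+1\}$ and either ($u_i=v_i+1$, $u_{i+1}=v_{i+1}-1$) or ($u_i=v_i-1$, $u_{i+1}=v_{i+1}+1$), with arithmetic in coordinates $0$ and $m+1$ taken in $\mathbb{Z}_n$ and all entries required to stay in their allowed sets. $0$ denotes the all-zero vertex; $\mathrm{diam}$ is the graph diameter and $\mathrm{ecc}_G(x)$ the maximum distance from $x$ in $G$. -}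

module Defs where

open import Data.Nat using (ℕ; zero; suc; _≤_; _<_)
open import Data.Integer as ℤ using (ℤ; +_; -_; _-_; 0ℤ; 1ℤ; -1ℤ)
open import Data.Integer.Divisibility using (_∣_)
open import Data.Fin using (Fin; toℕ; inject₁) renaming (suc to fsuc)
open import Data.Vec using (Vec; lookup; foldr; replicate)
open import Data.Product using (Σ; ∃; _×_; _,_)
open import Data.Sum using (_⊎_)
open import Relation.Nullary using (¬_)
open import Relation.Binary.PropositionalEquality using (_≡_)

-- A vertex of Y_{n,m} / Z_{n,m} is encoded as a vector of m+2 integers
-- (v_0, v_1, ..., v_m, v_{m+1}).  The end coordinates v_0, v_{m+1}
-- represent elements of ℤ_n by their canonical representatives 0..n-1.

IsEnd : (m : ℕ) → Fin (suc (suc m)) → Set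
IsEnd m j = toℕ j ≡ 0 ⊎ toℕ j ≡ suc m

CoordEq : (n m : ℕ) → Fin (suc (suc m)) → ℤ → ℤ → Set
CoordEq n m j a b = (IsEnd m j → (+ n) ∣ (a - b)) × (¬ IsEnd m j → a ≡ b)

sumℤ : ∀ {k} → Vec ℤ k → ℤ
sumℤ = foldr _ ℤ._+_ 0ℤ

Bit : ℤ → Set
Bit a = a ≡ 0ℤ ⊎ a ≡ 1ℤ

Trit : ℤ → Set
Trit a = a ≡ -1ℤ ⊎ (a ≡ 0ℤ ⊎ a ≡ 1ℤ)

Valid : (S : ℤ → Set) (n m : ℕ) → Vec ℤ (suc (suc m)) → Set
Valid S n m v =
  (∀ j → IsEnd m j → (+ 0 ℤ.≤ lookup v j) × (lookup v j ℤ.< + n)) ×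
  (∀ j → ¬ IsEnd m j → S (lookup v j)) ×
  ((+ n) ∣ sumℤ v)

Shift : (n m : ℕ) → Fin (suc m) → Vec ℤ (suc (suc m)) → Vec ℤ (suc (suc m)) → Set
Shift n m i u v =
  CoordEq n m (inject₁ i) (lookup u (inject₁ i)) (lookup v (inject₁ i) ℤ.+ 1ℤ) ×
  CoordEq n m (fsuc i) (lookup u (fsuc i)) (lookup v (fsuc i) - 1ℤ) ×
  (∀ j → ¬ j ≡ inject₁ i → ¬ j ≡ fsuc i → lookup u j ≡ lookup v j)

Adj : (S : ℤ → Set) (n m : ℕ) → Vec ℤ (suc (suc m)) → Vec ℤ (suc (suc m)) → Set
Adj S n m u v = Valid S n m u × Valid S n m v ×
  Σ (Fin (suc m)) (λ i → Shift n m i u v ⊎ Shift n m i v u)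

data Walk (S : ℤ → Set) (n m : ℕ) : ℕ → Vec ℤ (suc (suc m)) → Vec ℤ (suc (suc m)) → Set where
  here : ∀ {u} → Walk S n m 0 u u
  step : ∀ {k u w v} → Adj S n m u w → Walk S n m k w v → Walk S n m (suc k) u v

DistLe : (S : ℤ → Set) (n m : ℕ) → Vec ℤ (suc (suc m)) → Vec ℤ (suc (suc m)) → ℕ → Set
DistLe S n m u v d = Σ ℕ (λ k → k ≤ d × Walk S n m k u v)

IsDiam : (S : ℤ → Set) (n m : ℕ) → ℕ → Set
IsDiam S n m d =
  (∀ u v → Valid S n m u → Valid S n m v → DistLe S n m u v d) ×
  (∀ d' → (∀ u v → Valid S n m u → Valid S n m v → DistLe S n m u v d') → d ≤ d')

IsEcc : (S : ℤ → Set) (n m : ℕ) → Vec ℤ (suc (suc m)) → ℕ → Set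
IsEcc S n m x e =
  (∀ v → Valid S n m v → DistLe S n m x v e) ×
  (∀ e' → (∀ v → Valid S n m v → DistLe S n m x v e') → e ≤ e')

zeroV : (m : ℕ) → Vec ℤ (suc (suc m))
zeroV m = replicate _ 0ℤ

-- Yoke graph Y_{n,m}: middle set {0,1};  dYoke graph Z_{n,m}: middle set {-1,0,1}

-- Let a walk lead from x to v. Every step moves one unit across one of the edges
-- 0, …, m, edge k joining coordinates k and k+1. If c is the net number of units
-- moved leftwards across edge 0, then c ≡ v₀ − x₀ (mod n), and the net number moved
-- across edge k is the load c + Σ_{1≤j≤k} (v_j − x_j); so the walk is at least as long
-- as the sum of the absolute loads. Conversely, while some load is non-zero a single
-- legal move lowers this sum by one, so the distance is the least such sum over all
-- c ≡ v₀ − x₀. It depends only on the residue of v₀ − x₀ and on the profile of middle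
-- differences, a vector in {−1, 0, 1}ᵐ. Pairs of vertices of Y_{n,m} and vertices of
-- Z_{n,m} seen from 0 realise every residue and every profile, so the diameter and the
-- eccentricity are both the least e such that every residue and profile admit a c whose
-- sum of absolute loads is at most e.
module Submission where

open import Defs
open import Data.Nat as ℕ using (ℕ; zero; suc; z≤n; s≤s; NonZero)
import Data.Nat.Properties as ℕP
open import Data.Integer as ℤ using (ℤ; +_; -[1+_]; 0ℤ; 1ℤ; -1ℤ; ∣_∣; _+_; _-_; -_; _≤_; _<_)
import Data.Integer.Properties as ℤP
open import Data.Integer.Tactic.RingSolver using (solve-∀)
open import Data.Integer.Divisibility using () renaming (_∣_ to _∣ᵤ_)
open import Data.Integer.Divisibility.Signed
  using (_∣_; _∣?_; divides; ∣ᵤ⇒∣; ∣⇒∣ᵤ; ∣m∣n⇒∣m+n; ∣m∣n⇒∣m-n; ∣m⇒∣-m; ∣m+n∣m⇒∣n)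
open import Data.Integer.DivMod using (_%ℕ_; _/ℕ_; n%ℕd<d; a≡a%ℕn+[a/ℕn]*n)
open import Data.Vec using (Vec; []; _∷_; lookup; replicate; map; _∷ʳ_)
open import Data.Fin using (Fin; toℕ; inject₁; fromℕ; fromℕ<) renaming (zero to fzero; suc to fsuc)
import Data.Fin.Properties as FP
open import Data.Product using (Σ; ∃; ∃₂; _×_; _,_; proj₁; proj₂)
open import Data.Sum using (_⊎_; inj₁; inj₂)
open import Data.Empty using (⊥-elim)
open import Function using (case_of_)
open import Relation.Nullary using (¬_; Dec; yes; no)
open import Relation.Nullary.Decidable using (map′; _×-dec_; _⊎-dec_)
open import Data.Nat.Induction using (<-rec)
open import Relation.Binary.PropositionalEquality
open import Relation.Binary.Definitions using (tri<; tri≈; tri>)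
open import Algebra.Properties.CommutativeSemigroup ℕP.+-commutativeSemigroup
  using () renaming (interchange to +-interchange)

at : ∀ {k} → Vec ℤ k → ℕ → ℤ
at []      _       = 0ℤ
at (a ∷ _) zero    = a
at (_ ∷ v) (suc q) = at v q

lookup≡at : ∀ {k} (v : Vec ℤ k) (i : Fin k) → lookup v i ≡ at v (toℕ i)
lookup≡at (_ ∷ _) fzero    = refl
lookup≡at (_ ∷ v) (fsuc i) = lookup≡at v i

lookup-inject₁ : ∀ {k} (v : Vec ℤ (suc k)) (i : Fin k) → lookup v (inject₁ i) ≡ at v (toℕ i)
lookup-inject₁ v i = trans (lookup≡at v (inject₁ i)) (cong (at v) (FP.toℕ-inject₁ i))

at-ext : ∀ {k} (u v : Vec ℤ k) → (∀ q → q ℕ.< k → at u q ≡ at v q) → u ≡ v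
at-ext []      []      _ = refl
at-ext (a ∷ u) (b ∷ v) h = cong₂ _∷_ (h 0 (s≤s z≤n)) (at-ext u v (λ q q< → h (suc q) (s≤s q<)))

at-replicate : ∀ k q → at (replicate k 0ℤ) q ≡ 0ℤ
at-replicate zero    _       = refl
at-replicate (suc k) zero    = refl
at-replicate (suc k) (suc q) = at-replicate k q

sumℤ-replicate : ∀ k → sumℤ (replicate k 0ℤ) ≡ 0ℤ
sumℤ-replicate zero    = refl
sumℤ-replicate (suc k) = cong (_+_ 0ℤ) (sumℤ-replicate k)

at-map-∈ : ∀ {A : Set} {k} {P : ℤ → Set} (f : A → ℤ) → (∀ a → P (f a)) →
           (t : Vec A k) → ∀ q → q ℕ.< k → P (at (map f t) q)
at-map-∈ f P-f (a ∷ _) zero    _        = P-f a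
at-map-∈ {P = P} f P-f (_ ∷ t) (suc q) (s≤s q<) = at-map-∈ {P = P} f P-f t q q<

at-∷ʳ : ∀ {k} (v : Vec ℤ k) b q → q ℕ.< k → at (v ∷ʳ b) q ≡ at v q
at-∷ʳ (_ ∷ _) _ zero    _        = refl
at-∷ʳ (_ ∷ v) b (suc q) (s≤s q<) = at-∷ʳ v b q q<

at-∷ʳ-last : ∀ {k} (v : Vec ℤ k) b → at (v ∷ʳ b) k ≡ b
at-∷ʳ-last []      _ = refl
at-∷ʳ-last (_ ∷ v) b = at-∷ʳ-last v b

sumℤ-∷ʳ : ∀ {k} (v : Vec ℤ k) b → sumℤ (v ∷ʳ b) ≡ sumℤ v + b
sumℤ-∷ʳ []      b = ℤP.+-comm b 0ℤ
sumℤ-∷ʳ (a ∷ v) b = trans (cong (_+_ a) (sumℤ-∷ʳ v b)) (sym (ℤP.+-assoc a (sumℤ v) b))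

setAt : ∀ {k} → Vec ℤ k → ℕ → ℤ → Vec ℤ k
setAt []      _       _ = []
setAt (_ ∷ v) zero    a = a ∷ v
setAt (b ∷ v) (suc q) a = b ∷ setAt v q a

at-setAt-≡ : ∀ {k} (v : Vec ℤ k) q a → q ℕ.< k → at (setAt v q a) q ≡ a
at-setAt-≡ (_ ∷ _) zero    _ _        = refl
at-setAt-≡ (_ ∷ v) (suc q) a (s≤s q<) = at-setAt-≡ v q a q<

at-setAt-≢ : ∀ {k} (v : Vec ℤ k) q a q' → q ≢ q' → at (setAt v q a) q' ≡ at v q'
at-setAt-≢ []      _       _ _        _  = refl
at-setAt-≢ (_ ∷ _) zero    _ zero     ne = ⊥-elim (ne refl)
at-setAt-≢ (_ ∷ _) zero    _ (suc _)  _  = refl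
at-setAt-≢ (_ ∷ _) (suc _) _ zero     _  = refl
at-setAt-≢ (_ ∷ v) (suc q) a (suc q') ne = at-setAt-≢ v q a q' (λ e → ne (cong suc e))

sumℤ-setAt : ∀ {k} (v : Vec ℤ k) q a → q ℕ.< k → sumℤ (setAt v q a) ≡ sumℤ v + (a - at v q)
sumℤ-setAt (b ∷ v) zero    a _ = ring a b (sumℤ v)
  where
  ring : ∀ a b s → a + s ≡ b + s + (a - b)
  ring = solve-∀
sumℤ-setAt (b ∷ v) (suc q) a (s≤s q<) rewrite sumℤ-setAt v q a q< =
  sym (ℤP.+-assoc b (sumℤ v) (a - at v q))

sumℤ-except : ∀ {k} (x v : Vec ℤ k) q → q ℕ.< k → (∀ j → j ℕ.< k → j ≢ q → at x j ≡ at v j) →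
              sumℤ x ≡ sumℤ v + (at x q - at v q)
sumℤ-except x v q q<k agree = trans (cong sumℤ x≡v[q]) (sumℤ-setAt v q (at x q) q<k)
  where
  x≡v[q] : x ≡ setAt v q (at x q)
  x≡v[q] = at-ext x _ λ j j<k → case j ℕ.≟ q of λ where
    (yes refl) → sym (at-setAt-≡ v q (at x q) q<k)
    (no  j≢q)  → trans (agree j j<k j≢q) (sym (at-setAt-≢ v q (at x q) j (λ e → j≢q (sym e))))

sumBelow : (ℕ → ℕ) → ℕ → ℕ
sumBelow f zero    = 0
sumBelow f (suc N) = sumBelow f N ℕ.+ f N

module _ {f g : ℕ → ℕ} where

  sumBelow-cong : ∀ N → (∀ k → k ℕ.< N → f k ≡ g k) → sumBelow f N ≡ sumBelow g N
  sumBelow-cong zero    _ = refl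
  sumBelow-cong (suc N) h = cong₂ ℕ._+_ (sumBelow-cong N (λ k k< → h k (ℕP.m≤n⇒m≤1+n k<))) (h N ℕP.≤-refl)

  sumBelow-mono-≤ : ∀ N → (∀ k → k ℕ.< N → f k ℕ.≤ g k) → sumBelow f N ℕ.≤ sumBelow g N
  sumBelow-mono-≤ zero    _ = z≤n
  sumBelow-mono-≤ (suc N) h = ℕP.+-mono-≤ (sumBelow-mono-≤ N (λ k k< → h k (ℕP.m≤n⇒m≤1+n k<))) (h N ℕP.≤-refl)

  sumBelow-+ : ∀ N → sumBelow (λ k → f k ℕ.+ g k) N ≡ sumBelow f N ℕ.+ sumBelow g N
  sumBelow-+ zero    = refl
  sumBelow-+ (suc N) rewrite sumBelow-+ N = +-interchange (sumBelow f N) (sumBelow g N) (f N) (g N)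

module _ {f : ℕ → ℕ} where

  sumBelow≡0⇒ : ∀ N → sumBelow f N ≡ 0 → ∀ k → k ℕ.< N → f k ≡ 0
  sumBelow≡0⇒ (suc N) s≡0 k k<1+N with k ℕ.≟ N
  ... | yes refl = ℕP.m+n≡0⇒n≡0 (sumBelow f N) s≡0
  ... | no  k≢N  = sumBelow≡0⇒ N (ℕP.m+n≡0⇒m≡0 (sumBelow f N) s≡0) k (ℕP.≤∧≢⇒< (ℕ.s≤s⁻¹ k<1+N) k≢N)

  sumBelow≢0⇒ : ∀ N → sumBelow f N ≢ 0 → ∃ λ k → k ℕ.< N × f k ≢ 0
  sumBelow≢0⇒ zero    s≢0 = ⊥-elim (s≢0 refl)
  sumBelow≢0⇒ (suc N) s≢0 with f N ℕ.≟ 0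
  ... | no  fN≢0 = N , ℕP.≤-refl , fN≢0
  ... | yes fN≡0 with sumBelow≢0⇒ N (λ s≡0 → s≢0 (cong₂ ℕ._+_ s≡0 fN≡0))
  ...   | k , k<N , fk≢0 = k , ℕP.m≤n⇒m≤1+n k<N , fk≢0

head≤sumBelow : ∀ f N → f 0 ℕ.≤ sumBelow f (suc N)
head≤sumBelow f zero    = ℕP.≤-refl
head≤sumBelow f (suc N) = ℕP.≤-trans (head≤sumBelow f N) (ℕP.m≤m+n _ _)

sumBelow-≤-* : ∀ f N B → (∀ k → k ℕ.< N → f k ℕ.≤ B) → sumBelow f N ℕ.≤ N ℕ.* B
sumBelow-≤-* f zero    B _ = z≤n
sumBelow-≤-* f (suc N) B h = ℕP.≤-trans
  (ℕP.+-mono-≤ (sumBelow-≤-* f N B (λ k k< → h k (ℕP.m≤n⇒m≤1+n k<))) (h N ℕP.≤-refl))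
  (ℕP.≤-reflexive (ℕP.+-comm (N ℕ.* B) B))

δ : ℕ → ℕ → ℤ
δ p k with p ℕ.≟ k
... | yes _ = 1ℤ
... | no  _ = 0ℤ

δ-off : ∀ {p k} → p ≢ k → δ p k ≡ 0ℤ
δ-off {p} {k} ne with p ℕ.≟ k
... | yes e = ⊥-elim (ne e)
... | no  _ = refl

∣a-δ∣+∣δ∣≡∣a∣ : ∀ a p k → (p ≡ k → 0ℤ < a) → ∣ a - δ p k ∣ ℕ.+ ∣ δ p k ∣ ≡ ∣ a ∣
∣a-δ∣+∣δ∣≡∣a∣ a p k h with p ℕ.≟ k
... | yes p≡k = go a (h p≡k)
  where
  go : ∀ a → 0ℤ < a → ∣ a - 1ℤ ∣ ℕ.+ 1 ≡ ∣ a ∣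
  go (+ suc j) _ = ℕP.+-comm j 1
  go (+ zero) (ℤ.+<+ ())
... | no  _   = trans (ℕP.+-identityʳ _) (cong ∣_∣ (ℤP.+-identityʳ a))

∣a+δ∣+∣δ∣≡∣a∣ : ∀ a p k → (p ≡ k → a < 0ℤ) → ∣ a + δ p k ∣ ℕ.+ ∣ δ p k ∣ ≡ ∣ a ∣
∣a+δ∣+∣δ∣≡∣a∣ a p k h with p ℕ.≟ k
... | yes p≡k = go a (h p≡k)
  where
  go : ∀ a → a < 0ℤ → ∣ a + 1ℤ ∣ ℕ.+ 1 ≡ ∣ a ∣
  go -[1+ zero  ] _ = refl
  go -[1+ suc j ] _ = ℕP.+-comm (suc j) 1
  go (+ _)        (ℤ.+<+ ())
... | no  _   = trans (ℕP.+-identityʳ _) (cong ∣_∣ (ℤP.+-identityʳ a))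

module _ (p : ℕ) where

  sumBelow-∣δ∣≡0 : ∀ N → N ℕ.≤ p → sumBelow (λ k → ∣ δ p k ∣) N ≡ 0
  sumBelow-∣δ∣≡0 zero    _   = refl
  sumBelow-∣δ∣≡0 (suc N) N<p rewrite δ-off (ℕP.>⇒≢ N<p) =
    trans (ℕP.+-identityʳ _) (sumBelow-∣δ∣≡0 N (ℕP.<⇒≤ N<p))

  sumBelow-∣δ∣≡1 : ∀ N → p ℕ.< N → sumBelow (λ k → ∣ δ p k ∣) N ≡ 1
  sumBelow-∣δ∣≡1 (suc N) p<1+N with p ℕ.≟ N
  ... | yes refl = cong (ℕ._+ 1) (sumBelow-∣δ∣≡0 p ℕP.≤-refl)
  ... | no  p≢N  = trans (ℕP.+-identityʳ _) (sumBelow-∣δ∣≡1 N (ℕP.≤∧≢⇒< (ℕ.s≤s⁻¹ p<1+N) p≢N))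

  sumBelow-∣δ∣≤1 : ∀ N → sumBelow (λ k → ∣ δ p k ∣) N ℕ.≤ 1
  sumBelow-∣δ∣≤1 N with ℕP.<-≤-connex p N
  ... | inj₁ p<N = ℕP.≤-reflexive (sumBelow-∣δ∣≡1 N p<N)
  ... | inj₂ N≤p = ℕP.≤-trans (ℕP.≤-reflexive (sumBelow-∣δ∣≡0 N N≤p)) z≤n

  sumBelow-≤-+1 : ∀ {f g} N → (∀ k → k ℕ.< N → f k ℕ.≤ g k ℕ.+ ∣ δ p k ∣) →
                  sumBelow f N ℕ.≤ sumBelow g N ℕ.+ 1
  sumBelow-≤-+1 {f} {g} N h = begin
    sumBelow f N                                          ≤⟨ sumBelow-mono-≤ N h ⟩
    sumBelow (λ k → g k ℕ.+ ∣ δ p k ∣) N                  ≡⟨ sumBelow-+ N ⟩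
    sumBelow g N ℕ.+ sumBelow (λ k → ∣ δ p k ∣) N         ≤⟨ ℕP.+-monoʳ-≤ (sumBelow g N) (sumBelow-∣δ∣≤1 N) ⟩
    sumBelow g N ℕ.+ 1                                    ∎
    where open ℕP.≤-Reasoning

  sumBelow-+1 : ∀ {f g} N → p ℕ.< N → (∀ k → k ℕ.< N → f k ℕ.+ ∣ δ p k ∣ ≡ g k) →
                sumBelow f N ℕ.+ 1 ≡ sumBelow g N
  sumBelow-+1 {f} {g} N p<N h = begin
    sumBelow f N ℕ.+ 1                                    ≡⟨ cong (sumBelow f N ℕ.+_) (sym (sumBelow-∣δ∣≡1 N p<N)) ⟩
    sumBelow f N ℕ.+ sumBelow (λ k → ∣ δ p k ∣) N         ≡⟨ sym (sumBelow-+ N) ⟩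
    sumBelow (λ k → f k ℕ.+ ∣ δ p k ∣) N                  ≡⟨ sumBelow-cong N h ⟩
    sumBelow g N                                          ∎
    where open ≡-Reasoning

infix 4 _≡_[mod_]
_≡_[mod_] : ℤ → ℤ → ℕ → Set
a ≡ b [mod n ] = + n ∣ (a - b)

IsResidue : ℕ → ℤ → Set
IsResidue n a = 0ℤ ≤ a × a < + n

<⇒IsResidue : ∀ {n r} → r ℕ.< n → IsResidue n (+ r)
<⇒IsResidue r<n = ℤ.+≤+ z≤n , ℤ.+<+ r<n

module _ {n : ℕ} where

  ≡⇒≡-mod : ∀ {a b} → a ≡ b → a ≡ b [mod n ]
  ≡⇒≡-mod {a} refl = divides 0ℤ (ℤP.+-inverseʳ a)

  ≡-mod-trans : ∀ {a b c} → a ≡ b [mod n ] → b ≡ c [mod n ] → a ≡ c [mod n ]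
  ≡-mod-trans {a} {b} {c} a≡b b≡c = subst (+ n ∣_) (ring a b c) (∣m∣n⇒∣m+n a≡b b≡c)
    where
    ring : ∀ a b c → a - b + (b - c) ≡ a - c
    ring = solve-∀

  winding-step : ∀ {c d x₀ y₀ v₀} → y₀ ≡ x₀ + d [mod n ] → c ≡ v₀ - y₀ [mod n ] → c + d ≡ v₀ - x₀ [mod n ]
  winding-step {c} {d} {x₀} {y₀} {v₀} y₀≡ c≡ = subst (+ n ∣_) (ring c d x₀ y₀ v₀) (∣m∣n⇒∣m-n c≡ y₀≡)
    where
    ring : ∀ c d x₀ y₀ v₀ → c - (v₀ - y₀) - (y₀ - (x₀ + d)) ≡ c + d - (v₀ - x₀)
    ring = solve-∀

  winding-step⁻ : ∀ {c d x₀ y₀ v₀} → x₀ ≡ y₀ + d [mod n ] → c ≡ v₀ - y₀ [mod n ] → c - d ≡ v₀ - x₀ [mod n ]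
  winding-step⁻ {c} {d} {x₀} {y₀} {v₀} x₀≡ c≡ = subst (+ n ∣_) (ring c d x₀ y₀ v₀) (∣m∣n⇒∣m+n c≡ x₀≡)
    where
    ring : ∀ c d x₀ y₀ v₀ → c - (v₀ - y₀) + (x₀ - (y₀ + d)) ≡ c - d - (v₀ - x₀)
    ring = solve-∀

  ≡-mod⇒≡ : ∀ {a b} → IsResidue n a → IsResidue n b → a ≡ b [mod n ] → a ≡ b
  ≡-mod⇒≡ {+ a} {+ b} (_ , ℤ.+<+ a<n) (_ , ℤ.+<+ b<n) a≡b = go (∣⇒∣ᵤ a≡b)
    where
    import Data.Nat.Divisibility as ND
    ∣a-b∣<n : ∣ + a - + b ∣ ℕ.< n
    ∣a-b∣<n = ℕP.≤-<-trans (subst (λ z → ∣ z ∣ ℕ.≤ a ℕ.⊔ b) (sym (ℤP.m-n≡m⊖n a b)) (ℤP.∣m⊝n∣≤m⊔n a b))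
                           (ℕP.⊔-lub a<n b<n)
    go : n ND.∣ ∣ + a - + b ∣ → + a ≡ + b
    go n∣ with ∣ + a - + b ∣ in eq
    ... | zero  = ℤP.i-j≡0⇒i≡j (+ a) (+ b) (ℤP.∣i∣≡0⇒i≡0 eq)
    ... | suc k = ⊥-elim (ℕP.<⇒≱ (subst (ℕ._< n) eq ∣a-b∣<n) (ND.∣⇒≤ n∣))

  ≡-mod-shift : ∀ {a b d} → a ≡ b + d [mod n ] → b ≡ a - d [mod n ]
  ≡-mod-shift {a} {b} {d} a≡b+d = subst (+ n ∣_) (ring a b d) (∣m⇒∣-m a≡b+d)
    where
    ring : ∀ a b d → - (a - (b + d)) ≡ b - (a - d)
    ring = solve-∀

shift-eq : ∀ {a b d} → a ≡ b + d → b ≡ a - d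
shift-eq {a} {b} {d} refl = ring b d
  where
  ring : ∀ b d → b ≡ b + d - d
  ring = solve-∀

module _ (n : ℕ) {{_ : NonZero n}} where

  wrap : ℤ → ℤ
  wrap z = + (z %ℕ n)

  wrap-residue : ∀ z → IsResidue n (wrap z)
  wrap-residue z = <⇒IsResidue (n%ℕd<d z n)

  wrap≡ : ∀ z → wrap z ≡ z [mod n ]
  wrap≡ z = divides (- (z /ℕ n)) (begin
    wrap z - z                          ≡⟨ cong (_-_ (wrap z)) (a≡a%ℕn+[a/ℕn]*n z n) ⟩
    wrap z - (wrap z + z /ℕ n ℤ.* + n)  ≡⟨ ring (wrap z) (z /ℕ n) (+ n) ⟩
    - (z /ℕ n) ℤ.* + n                  ∎)
    where
    open ≡-Reasoning
    ring : ∀ w q n → w - (w + q ℤ.* n) ≡ - q ℤ.* n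
    ring = solve-∀

  wrapIf : ∀ {A : Set} → Dec A → ℤ → ℤ
  wrapIf (yes _) z = wrap z
  wrapIf (no  _) z = z

  wrapIf-≡-mod : ∀ {A : Set} (a? : Dec A) z → wrapIf a? z ≡ z [mod n ]
  wrapIf-≡-mod (yes _) z = wrap≡ z
  wrapIf-≡-mod (no  _) z = ≡⇒≡-mod {n} {z} refl

  wrapIf-≡ : ∀ {A : Set} (a? : Dec A) z → ¬ A → wrapIf a? z ≡ z
  wrapIf-≡ (yes a) z ¬a = ⊥-elim (¬a a)
  wrapIf-≡ (no  _) z _  = refl

  wrapIf-residue : ∀ {A : Set} (a? : Dec A) z → A → IsResidue n (wrapIf a? z)
  wrapIf-residue (yes _) z _ = wrap-residue z
  wrapIf-residue (no ¬a) z a = ⊥-elim (¬a a)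

-- Loads and costs of a flow

load : ℤ → (ℕ → ℤ) → ℕ → ℤ
load c D zero    = c
load c D (suc k) = load c D k + D k

cost : ℤ → (ℕ → ℤ) → ℕ → ℕ
cost c D m = sumBelow (λ k → ∣ load c D k ∣) (suc m)

load-cong : ∀ c {D D'} k → (∀ j → j ℕ.< k → D j ≡ D' j) → load c D k ≡ load c D' k
load-cong c zero    _ = refl
load-cong c (suc k) h = cong₂ _+_ (load-cong c k (λ j j< → h j (ℕP.m≤n⇒m≤1+n j<))) (h k ℕP.≤-refl)

cost-cong : ∀ c {D D'} m → (∀ j → j ℕ.< m → D j ≡ D' j) → cost c D m ≡ cost c D' m
cost-cong c m h = sumBelow-cong (suc m) λ k k≤m →
  cong ∣_∣ (load-cong c k (λ j j<k → h j (ℕP.<-≤-trans j<k (ℕ.s≤s⁻¹ k≤m))))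

∣c∣≤cost : ∀ c D m → ∣ c ∣ ℕ.≤ cost c D m
∣c∣≤cost c D m = head≤sumBelow (λ k → ∣ load c D k ∣) m

∣load∣≤ : ∀ c D k → (∀ j → ∣ D j ∣ ℕ.≤ 1) → ∣ load c D k ∣ ℕ.≤ ∣ c ∣ ℕ.+ k
∣load∣≤ c D zero    _     = ℕP.≤-reflexive (sym (ℕP.+-identityʳ ∣ c ∣))
∣load∣≤ c D (suc k) ∣D∣≤1 = begin
  ∣ load c D k + D k ∣           ≤⟨ ℤP.∣i+j∣≤∣i∣+∣j∣ (load c D k) (D k) ⟩
  ∣ load c D k ∣ ℕ.+ ∣ D k ∣      ≤⟨ ℕP.+-mono-≤ (∣load∣≤ c D k ∣D∣≤1) (∣D∣≤1 k) ⟩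
  ∣ c ∣ ℕ.+ k ℕ.+ 1              ≡⟨ trans (ℕP.+-assoc ∣ c ∣ k 1) (cong (∣ c ∣ ℕ.+_) (ℕP.+-comm k 1)) ⟩
  ∣ c ∣ ℕ.+ suc k                ∎
  where open ℕP.≤-Reasoning

cost-≤-suc : ∀ {c c' D D' m k} p → (∀ j → j ℕ.≤ m → ∣ load c D j ∣ ℕ.≤ ∣ load c' D' j ∣ ℕ.+ ∣ δ p j ∣) →
             cost c' D' m ℕ.≤ k → cost c D m ℕ.≤ suc k
cost-≤-suc {m = m} {k} p h c'≤k = ℕP.≤-trans (sumBelow-≤-+1 p (suc m) (λ j j≤m → h j (ℕ.s≤s⁻¹ j≤m)))
  (ℕP.≤-trans (ℕP.+-monoˡ-≤ 1 c'≤k) (ℕP.≤-reflexive (ℕP.+-comm k 1)))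

cost-≡-suc : ∀ {c c' D D' m N} p → p ℕ.≤ m → (∀ j → j ℕ.≤ m → ∣ load c' D' j ∣ ℕ.+ ∣ δ p j ∣ ≡ ∣ load c D j ∣) →
             cost c D m ≡ suc N → cost c' D' m ≡ N
cost-≡-suc {m = m} p p≤m h c≡ = ℕP.suc-injective
  (trans (ℕP.+-comm 1 _) (trans (sumBelow-+1 p (suc m) (s≤s p≤m) (λ j j≤m → h j (ℕ.s≤s⁻¹ j≤m))) c≡))

Vertex : ℕ → Set
Vertex m = Vec ℤ (suc (suc m))

-- Indexed from the first middle coordinate, so that load c (gap x v) k is the load of edge k.
gap : ∀ {k} → Vec ℤ (suc k) → Vec ℤ (suc k) → ℕ → ℤ
gap x v j = at v (suc j) - at x (suc j)

cost-self : ∀ {k} (x : Vec ℤ (suc k)) m → cost 0ℤ (gap x x) m ≡ 0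
cost-self x m = ℕP.n≤0⇒n≡0 (subst (cost 0ℤ (gap x x) m ℕ.≤_) (ℕP.*-zeroʳ (suc m))
  (sumBelow-≤-* _ (suc m) 0 (λ k _ → ℕP.≤-reflexive (cong ∣_∣ (load-self k)))))
  where
  load-self : ∀ k → load 0ℤ (gap x x) k ≡ 0ℤ
  load-self zero    = refl
  load-self (suc k) = cong₂ _+_ (load-self k) (ℤP.+-inverseʳ (at x (suc k)))

IsWinding : ∀ {k} → ℕ → ℤ → Vec ℤ k → Vec ℤ k → Set
IsWinding n c x v = c ≡ at v 0 - at x 0 [mod n ]

-- Where the move at a positive load is blocked, the neighbouring load is at least as large,
-- because the target vertex has its coordinates in [lo, hi] too; so some move is legal.
module Search (m : ℕ) (lo hi : ℤ) (lo<hi : lo < hi) (X V T : ℕ → ℤ)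
  (V∈ : ∀ j → 1 ℕ.≤ j → j ℕ.≤ m → lo ≤ V j × V j ≤ hi)
  (T-suc : ∀ j → T (suc j) ≡ T j + (V (suc j) - X (suc j))) where

  Movable : ℕ → Set
  Movable p = p ℕ.≤ m × (p ≢ 0 → X p < hi) × (p ≢ m → lo < X (suc p))

  positive-right : ∀ k → suc k ℕ.≤ m → X (suc k) ≤ lo → 0ℤ < T k → 0ℤ < T (suc k)
  positive-right k k<m X≤lo 0<Tk = begin-strict
    0ℤ                              <⟨ 0<Tk ⟩
    T k                             ≡⟨ ℤP.+-identityʳ (T k) ⟨
    T k + 0ℤ                        ≤⟨ ℤP.+-monoʳ-≤ (T k) (ℤP.i≤j⇒0≤j-i X≤V) ⟩
    T k + (V (suc k) - X (suc k))   ≡⟨ T-suc k ⟨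
    T (suc k)                       ∎
    where
    open ℤP.≤-Reasoning
    X≤V = ℤP.≤-trans X≤lo (proj₁ (V∈ (suc k) (s≤s z≤n) k<m))

  positive-left : ∀ k → suc k ℕ.≤ m → hi ≤ X (suc k) → 0ℤ < T (suc k) → 0ℤ < T k
  positive-left k k<m hi≤X 0<T = begin-strict
    0ℤ                              <⟨ 0<T ⟩
    T (suc k)                       ≡⟨ T-suc k ⟩
    T k + (V (suc k) - X (suc k))   ≤⟨ ℤP.+-monoʳ-≤ (T k) (ℤP.i≤j⇒i-j≤0 V≤X) ⟩
    T k + 0ℤ                        ≡⟨ ℤP.+-identityʳ (T k) ⟩
    T k                             ∎
    where
    open ℤP.≤-Reasoning
    V≤X = ℤP.≤-trans (proj₂ (V∈ (suc k) (s≤s z≤n) k<m)) hi≤X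

  search-right : ∀ f k → f ℕ.+ k ≡ m → 0ℤ < T k → (k ≢ 0 → X k < hi) → ∃ λ p → 0ℤ < T p × Movable p
  search-right zero    k k≡m 0<Tk left = k , 0<Tk , ℕP.≤-reflexive k≡m , left , λ k≢m → ⊥-elim (k≢m k≡m)
  search-right (suc f) k f+k≡m 0<Tk left with lo ℤ.<? X (suc k)
  ... | yes lo<X = k , 0<Tk , ℕP.≤-trans (ℕP.m≤n+m k (suc f)) (ℕP.≤-reflexive f+k≡m) , left , λ _ → lo<X
  ... | no  lo≮X = search-right f (suc k) (trans (ℕP.+-suc f k) f+k≡m)
                     (positive-right k k<m X≤lo 0<Tk) (λ _ → ℤP.≤-<-trans X≤lo lo<hi)
    where
    X≤lo = ℤP.≮⇒≥ lo≮X
    k<m : suc k ℕ.≤ m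
    k<m = subst (suc k ℕ.≤_) f+k≡m (s≤s (ℕP.m≤n+m k f))

  search-left : ∀ k → k ℕ.≤ m → 0ℤ < T k → (k ≢ m → lo < X (suc k)) → ∃ λ p → 0ℤ < T p × Movable p
  search-left zero    k≤m 0<Tk right = 0 , 0<Tk , k≤m , (λ 0≢0 → ⊥-elim (0≢0 refl)) , right
  search-left (suc k) k≤m 0<Tk right with X (suc k) ℤ.<? hi
  ... | yes X<hi = suc k , 0<Tk , k≤m , (λ _ → X<hi) , right
  ... | no  X≮hi = search-left k (ℕP.<⇒≤ k≤m) (positive-left k k≤m hi≤X 0<Tk) (λ _ → ℤP.<-≤-trans lo<hi hi≤X)
    where hi≤X = ℤP.≮⇒≥ X≮hi

  search : ∀ K → K ℕ.≤ m → 0ℤ < T K → ∃ λ p → 0ℤ < T p × Movable p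
  search zero    _   0<TK = search-right m 0 (ℕP.+-identityʳ m) 0<TK (λ 0≢0 → ⊥-elim (0≢0 refl))
  search (suc K) K<m 0<TK with X (suc K) ℤ.<? hi
  ... | yes X<hi = search-right (m ℕ.∸ suc K) (suc K) (ℕP.m∸n+n≡m K<m) 0<TK (λ _ → X<hi)
  ... | no  X≮hi = search-left K (ℕP.<⇒≤ K<m) (positive-left K K<m hi≤X 0<TK) (λ _ → ℤP.<-≤-trans lo<hi hi≤X)
    where hi≤X = ℤP.≮⇒≥ X≮hi

module Search⁻ (m : ℕ) (lo hi : ℤ) (lo<hi : lo < hi) (X V T : ℕ → ℤ)
  (V∈ : ∀ j → 1 ℕ.≤ j → j ℕ.≤ m → lo ≤ V j × V j ≤ hi)
  (T-suc : ∀ j → T (suc j) ≡ T j + (V (suc j) - X (suc j))) where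

  private
    neg∈ : ∀ {W : ℕ → ℤ} → (∀ j → 1 ℕ.≤ j → j ℕ.≤ m → lo ≤ W j × W j ≤ hi) →
           ∀ j → 1 ℕ.≤ j → j ℕ.≤ m → - hi ≤ - W j × - W j ≤ - lo
    neg∈ W∈ j 1≤j j≤m = ℤP.neg-mono-≤ (proj₂ (W∈ j 1≤j j≤m)) , ℤP.neg-mono-≤ (proj₁ (W∈ j 1≤j j≤m))

    negT-suc : ∀ j → - T (suc j) ≡ - T j + (- V (suc j) - - X (suc j))
    negT-suc j = trans (cong -_ (T-suc j)) (ring (T j) (V (suc j)) (X (suc j)))
      where
      ring : ∀ t v x → - (t + (v - x)) ≡ - t + (- v - - x)
      ring = solve-∀

    open Search m (- hi) (- lo) (ℤP.neg-mono-< lo<hi) (λ j → - X j) (λ j → - V j) (λ j → - T j)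
                (neg∈ V∈) negT-suc

  search⁻ : ∀ K → K ℕ.≤ m → T K < 0ℤ →
            ∃ λ p → T p < 0ℤ × p ℕ.≤ m × (p ≢ 0 → lo < X p) × (p ≢ m → X (suc p) < hi)
  search⁻ K K≤m TK<0 with search K K≤m (ℤP.neg-mono-< TK<0)
  ... | p , 0<-Tp , p≤m , left , right =
    p , ℤP.neg-cancel-< 0<-Tp , p≤m ,
    (λ p≢0 → ℤP.neg-cancel-< (left p≢0)) , (λ p≢m → ℤP.neg-cancel-< (right p≢m))

-- Moves along edges

module _ (n m : ℕ) where

  record Move (p : ℕ) (y x : Vertex m) : Set where
    field
      left-end  : p ≡ 0 → at y 0 ≡ at x 0 + 1ℤ [mod n ]
      left      : p ≢ 0 → at y p ≡ at x p + 1ℤ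
      right     : p ≢ m → at y (suc p) ≡ at x (suc p) - 1ℤ
      right-end : p ≡ m → at y (suc p) ≡ at x (suc p) - 1ℤ [mod n ]
      elsewhere : ∀ q → q ℕ.< suc (suc m) → q ≢ p → q ≢ suc p → at y q ≡ at x q

  shift⇒move : ∀ i {y x} → Shift n m i y x → Move (toℕ i) y x
  shift⇒move i {y} {x} (c₁ , c₂ , c₃) = record
    { left-end  = λ p≡0 → subst₂ (λ a b → a ≡ b + 1ℤ [mod n ]) (ly p≡0) (lx p≡0)
                              (∣ᵤ⇒∣ (proj₁ c₁ (inj₁ (trans (FP.toℕ-inject₁ i) p≡0))))
    ; left      = λ p≢0 → subst₂ (λ a b → a ≡ b + 1ℤ) (lookup-inject₁ y i) (lookup-inject₁ x i)
                              (proj₂ c₁ (not-end p≢0))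
    ; right     = λ p≢m → subst₂ (λ a b → a ≡ b - 1ℤ) (lookup≡at y (fsuc i)) (lookup≡at x (fsuc i))
                              (proj₂ c₂ λ { (inj₁ ()) ; (inj₂ e) → p≢m (ℕP.suc-injective e) })
    ; right-end = λ p≡m → subst₂ (λ a b → a ≡ b - 1ℤ [mod n ]) (lookup≡at y (fsuc i)) (lookup≡at x (fsuc i))
                              (∣ᵤ⇒∣ (proj₁ c₂ (inj₂ (cong suc p≡m))))
    ; elsewhere = elsewhere
    }
    where
    ly : toℕ i ≡ 0 → lookup y (inject₁ i) ≡ at y 0
    ly p≡0 = trans (lookup-inject₁ y i) (cong (at y) p≡0)
    lx : toℕ i ≡ 0 → lookup x (inject₁ i) ≡ at x 0
    lx p≡0 = trans (lookup-inject₁ x i) (cong (at x) p≡0)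
    not-end : toℕ i ≢ 0 → ¬ IsEnd m (inject₁ i)
    not-end p≢0 (inj₁ e) = p≢0 (trans (sym (FP.toℕ-inject₁ i)) e)
    not-end p≢0 (inj₂ e) = ℕP.<⇒≢ (subst (ℕ._< suc m) (sym (FP.toℕ-inject₁ i)) (FP.toℕ<n i)) e
    elsewhere : ∀ q → q ℕ.< suc (suc m) → q ≢ toℕ i → q ≢ suc (toℕ i) → at y q ≡ at x q
    elsewhere q q< q≢p q≢p+1 = subst (λ k → at y k ≡ at x k) (FP.toℕ-fromℕ< q<)
      (subst₂ _≡_ (lookup≡at y j) (lookup≡at x j)
        (c₃ j (λ e → q≢p (trans (sym (FP.toℕ-fromℕ< q<)) (trans (cong toℕ e) (FP.toℕ-inject₁ i))))
              (λ e → q≢p+1 (trans (sym (FP.toℕ-fromℕ< q<)) (cong toℕ e)))))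
      where j = fromℕ< q<

  move⇒shift : ∀ i {y x} → Move (toℕ i) y x → Shift n m i y x
  move⇒shift i {y} {x} mv = c₁ , c₂ , c₃
    where
    open Move mv
    p = toℕ i

    c₁ : CoordEq n m (inject₁ i) (lookup y (inject₁ i)) (lookup x (inject₁ i) + 1ℤ)
    c₁ rewrite lookup-inject₁ y i | lookup-inject₁ x i = end , middle
      where
      end : IsEnd m (inject₁ i) → + n ∣ᵤ (at y p - (at x p + 1ℤ))
      end _ with p ℕ.≟ 0
      ... | yes p≡0 = ∣⇒∣ᵤ (subst (λ k → at y k ≡ at x k + 1ℤ [mod n ]) (sym p≡0) (left-end p≡0))
      ... | no  p≢0 = ∣⇒∣ᵤ (≡⇒≡-mod (left p≢0))
      middle : ¬ IsEnd m (inject₁ i) → at y p ≡ at x p + 1ℤ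
      middle ¬end = left (λ p≡0 → ¬end (inj₁ (trans (FP.toℕ-inject₁ i) p≡0)))

    c₂ : CoordEq n m (fsuc i) (lookup y (fsuc i)) (lookup x (fsuc i) - 1ℤ)
    c₂ rewrite lookup≡at y (fsuc i) | lookup≡at x (fsuc i) = end , middle
      where
      end : IsEnd m (fsuc i) → + n ∣ᵤ (at y (suc p) - (at x (suc p) - 1ℤ))
      end _ with p ℕ.≟ m
      ... | yes p≡m = ∣⇒∣ᵤ (right-end p≡m)
      ... | no  p≢m = ∣⇒∣ᵤ (≡⇒≡-mod (right p≢m))
      middle : ¬ IsEnd m (fsuc i) → at y (suc p) ≡ at x (suc p) - 1ℤ
      middle ¬end = right (λ p≡m → ¬end (inj₂ (cong suc p≡m)))

    c₃ : ∀ j → j ≢ inject₁ i → j ≢ fsuc i → lookup y j ≡ lookup x j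
    c₃ j j≢p j≢p+1 rewrite lookup≡at y j | lookup≡at x j =
      elsewhere (toℕ j) (FP.toℕ<n j)
        (λ e → j≢p (FP.toℕ-injective (trans e (sym (FP.toℕ-inject₁ i)))))
        (λ e → j≢p+1 (FP.toℕ-injective e))

  move⇒shift-at : ∀ {p y x} (p≤m : p ℕ.≤ m) → Move p y x → Shift n m (fromℕ< (s≤s p≤m)) y x
  move⇒shift-at {y = y} {x} p≤m mv =
    move⇒shift _ {y} {x} (subst (λ q → Move q y x) (sym (FP.toℕ-fromℕ< (s≤s p≤m))) mv)

  module _ {p : ℕ} {y x : Vertex m} (mv : Move p y x) where
    open Move mv

    move-winding : at y 0 ≡ at x 0 + δ p 0 [mod n ]
    move-winding with p ℕ.≟ 0
    ... | yes refl = left-end refl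
    ... | no  p≢0  = ≡⇒≡-mod (trans (elsewhere 0 (s≤s z≤n) (λ e → p≢0 (sym e)) (λ ()))
                                    (sym (ℤP.+-identityʳ (at x 0))))

    winding-move : ∀ {c v} → IsWinding n c y v → IsWinding n (c + δ p 0) x v
    winding-move {c} {v} = winding-step {c = c} {d = δ p 0} {at x 0} {at y 0} {at v 0} move-winding

    winding-move⁻ : ∀ {c v} → IsWinding n c x v → IsWinding n (c - δ p 0) y v
    winding-move⁻ {c} {v} = winding-step⁻ {c = c} {d = δ p 0} {at y 0} {at x 0} {at v 0} move-winding

    move-middle : ∀ k → suc k ℕ.≤ m → at y (suc k) + δ p k ≡ at x (suc k) + δ p (suc k)
    move-middle k k<m with p ℕ.≟ suc k
    ... | yes refl rewrite δ-off {suc k} {k} ℕP.1+n≢n =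
      trans (ℤP.+-identityʳ _) (left ℕP.1+n≢0)
    ... | no p≢1+k with p ℕ.≟ k
    ...   | yes refl =
      trans (cong (_+ 1ℤ) (right (ℕP.<⇒≢ k<m))) (ring (at x (suc p)))
      where
      ring : ∀ a → a - 1ℤ + 1ℤ ≡ a + 0ℤ
      ring = solve-∀
    ...   | no p≢k =
      cong (_+ 0ℤ) (elsewhere (suc k) (s≤s (ℕP.m≤n⇒m≤1+n k<m))
                              (λ e → p≢1+k (sym e)) (λ e → p≢k (ℕP.suc-injective (sym e))))

    load-move : ∀ c v k → k ℕ.≤ m → load (c + δ p 0) (gap x v) k ≡ load c (gap y v) k + δ p k
    load-move c v zero    _   = refl
    load-move c v (suc k) k<m = begin
      load (c + δ p 0) (gap x v) k + gap x v k                     ≡⟨ cong (_+ gap x v k) (load-move c v k (ℕP.<⇒≤ k<m)) ⟩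
      L + δ p k + (at v (suc k) - at x (suc k))                     ≡⟨ ring₁ L (δ p k) (δ p (suc k)) (at v (suc k)) (at x (suc k)) ⟩
      L + (at v (suc k) - (at x (suc k) + δ p (suc k))) + δ p (suc k) + δ p k
                                                                    ≡⟨ cong (λ z → L + (at v (suc k) - z) + δ p (suc k) + δ p k) (sym (move-middle k k<m)) ⟩
      L + (at v (suc k) - (at y (suc k) + δ p k)) + δ p (suc k) + δ p k
                                                                    ≡⟨ ring₂ L (δ p k) (δ p (suc k)) (at v (suc k)) (at y (suc k)) ⟩
      L + gap y v k + δ p (suc k)                                   ∎
      where
      open ≡-Reasoning
      L = load c (gap y v) k
      ring₁ : ∀ L d d' v x → L + d + (v - x) ≡ L + (v - (x + d')) + d' + d
      ring₁ = solve-∀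
      ring₂ : ∀ L d d' v y → L + (v - (y + d)) + d' + d ≡ L + (v - y) + d'
      ring₂ = solve-∀

    load-move⁻ : ∀ c v k → k ℕ.≤ m → load (c - δ p 0) (gap y v) k ≡ load c (gap x v) k - δ p k
    load-move⁻ c v k k≤m = trans (shift-eq (load-move (c - δ p 0) v k k≤m))
                                 (cong (λ c' → load c' (gap x v) k - δ p k) (cancel c (δ p 0)))
      where
      cancel : ∀ c d → c - d + d ≡ c
      cancel = solve-∀

    cost-move-≤ : ∀ {c v k} → cost c (gap y v) m ℕ.≤ k → cost (c + δ p 0) (gap x v) m ℕ.≤ suc k
    cost-move-≤ {c} {v} = cost-≤-suc p λ j j≤m →
      ℕP.≤-trans (ℕP.≤-reflexive (cong ∣_∣ (load-move c v j j≤m))) (ℤP.∣i+j∣≤∣i∣+∣j∣ (load c (gap y v) j) (δ p j))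

    cost-move⁻-≤ : ∀ {c v k} → cost c (gap x v) m ℕ.≤ k → cost (c - δ p 0) (gap y v) m ℕ.≤ suc k
    cost-move⁻-≤ {c} {v} = cost-≤-suc p λ j j≤m →
      ℕP.≤-trans (ℕP.≤-reflexive (cong ∣_∣ (load-move⁻ c v j j≤m))) (ℤP.∣i-j∣≤∣i∣+∣j∣ (load c (gap x v) j) (δ p j))

    cost-move-≡ : ∀ {c v N} → p ℕ.≤ m → load c (gap y v) p < 0ℤ →
                  cost c (gap y v) m ≡ suc N → cost (c + δ p 0) (gap x v) m ≡ N
    cost-move-≡ {c} {v} p≤m load<0 = cost-≡-suc p p≤m λ j j≤m →
      trans (cong (λ a → ∣ a ∣ ℕ.+ ∣ δ p j ∣) (load-move c v j j≤m))
            (∣a+δ∣+∣δ∣≡∣a∣ (load c (gap y v) j) p j λ { refl → load<0 })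

    cost-move⁻-≡ : ∀ {c v N} → p ℕ.≤ m → 0ℤ < load c (gap x v) p →
                   cost c (gap x v) m ≡ suc N → cost (c - δ p 0) (gap y v) m ≡ N
    cost-move⁻-≡ {c} {v} p≤m 0<load = cost-≡-suc p p≤m λ j j≤m →
      trans (cong (λ a → ∣ a ∣ ℕ.+ ∣ δ p j ∣) (load-move⁻ c v j j≤m))
            (∣a-δ∣+∣δ∣≡∣a∣ (load c (gap x v) j) p j λ { refl → 0<load })

  walk⇒cost : ∀ {S k x v} → Walk S n m k x v → ∃ λ c → IsWinding n c x v × cost c (gap x v) m ℕ.≤ k
  walk⇒cost {x = x} here = 0ℤ , ≡⇒≡-mod (sym (ℤP.+-inverseʳ (at x 0))) , ℕP.≤-reflexive (cost-self x m)
  walk⇒cost {x = x} {v} (step {w = w} (_ , _ , i , inj₂ w↤x) walk) =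
    let c , winding , cost≤ = walk⇒cost walk
        mv = shift⇒move i {w} {x} w↤x
    in c + δ (toℕ i) 0 , winding-move mv {c} {v} winding , cost-move-≤ mv {c} {v} cost≤
  walk⇒cost {x = x} {v} (step {w = w} (_ , _ , i , inj₁ x↤w) walk) =
    let c , winding , cost≤ = walk⇒cost walk
        mv = shift⇒move i {x} {w} x↤w
    in c - δ (toℕ i) 0 , winding-move⁻ mv {c} {v} winding , cost-move⁻-≤ mv {c} {v} cost≤

module _ {n m : ℕ} (S : ℤ → Set) (x : Vertex m) (valid : Valid S n m x) where

  valid-first : IsResidue n (at x 0)
  valid-first = subst (IsResidue n) (lookup≡at x fzero) (proj₁ valid fzero (inj₁ refl))

  valid-last : IsResidue n (at x (suc m))
  valid-last = subst (IsResidue n) (trans (lookup≡at x (fromℕ (suc m))) (cong (at x) (FP.toℕ-fromℕ (suc m))))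
                     (proj₁ valid (fromℕ (suc m)) (inj₂ (FP.toℕ-fromℕ (suc m))))

  valid-middle : ∀ q → 1 ℕ.≤ q → q ℕ.≤ m → S (at x q)
  valid-middle q 1≤q q≤m = subst S (trans (lookup≡at x j) (cong (at x) toℕj≡q)) (proj₁ (proj₂ valid) j middle)
    where
    q< : q ℕ.< suc (suc m)
    q< = s≤s (ℕP.m≤n⇒m≤1+n q≤m)
    j = fromℕ< q<
    toℕj≡q : toℕ j ≡ q
    toℕj≡q = FP.toℕ-fromℕ< q<
    middle : ¬ IsEnd m j
    middle (inj₁ j≡0)   = ℕP.<⇒≢ 1≤q (sym (trans (sym toℕj≡q) j≡0))
    middle (inj₂ j≡m+1) = ℕP.<⇒≢ (s≤s q≤m) (trans (sym toℕj≡q) j≡m+1)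

  valid-sum : + n ∣ sumℤ x
  valid-sum = ∣ᵤ⇒∣ (proj₂ (proj₂ valid))

mkValid : ∀ {n m S} (x : Vertex m) → IsResidue n (at x 0) → IsResidue n (at x (suc m)) →
          (∀ q → 1 ℕ.≤ q → q ℕ.≤ m → S (at x q)) → + n ∣ sumℤ x → Valid S n m x
mkValid {n} {m} {S} x first last middle n∣sum = ends , middles , ∣⇒∣ᵤ n∣sum
  where
  ends : ∀ j → IsEnd m j → IsResidue n (lookup x j)
  ends j (inj₁ j≡0)   rewrite lookup≡at x j | j≡0   = first
  ends j (inj₂ j≡m+1) rewrite lookup≡at x j | j≡m+1 = last
  middles : ∀ j → ¬ IsEnd m j → S (lookup x j)
  middles j ¬end rewrite lookup≡at x j = middle (toℕ j) (ℕP.n≢0⇒n>0 (λ e → ¬end (inj₁ e)))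
    (ℕ.s≤s⁻¹ (ℕP.≤∧≢⇒< (ℕ.s≤s⁻¹ (FP.toℕ<n j)) (λ e → ¬end (inj₂ e))))

module _ {n m : ℕ} {{_ : NonZero n}} where

  moveAt : Vertex m → ℕ → ℤ → Vertex m
  moveAt x p d = setAt (setAt x p (wrapIf n (p ℕ.≟ 0) (at x p + d)))
                       (suc p) (wrapIf n (p ℕ.≟ m) (at x (suc p) - d))

  module _ (x : Vertex m) {p} (p≤m : p ℕ.≤ m) (d : ℤ) where
    private
      y = moveAt x p d
      a = wrapIf n (p ℕ.≟ 0) (at x p + d)
      b = wrapIf n (p ℕ.≟ m) (at x (suc p) - d)

    moveAt-left : at y p ≡ a
    moveAt-left = trans (at-setAt-≢ (setAt x p a) (suc p) b p ℕP.1+n≢n)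
                        (at-setAt-≡ x p a (s≤s (ℕP.m≤n⇒m≤1+n p≤m)))

    moveAt-right : at y (suc p) ≡ b
    moveAt-right = at-setAt-≡ (setAt x p a) (suc p) b (s≤s (s≤s p≤m))

    moveAt-elsewhere : ∀ q → q ≢ p → q ≢ suc p → at y q ≡ at x q
    moveAt-elsewhere q q≢p q≢p+1 = trans (at-setAt-≢ (setAt x p a) (suc p) b q (λ e → q≢p+1 (sym e)))
                                         (at-setAt-≢ x p a q (λ e → q≢p (sym e)))

    moveAt-sum : + n ∣ sumℤ x → + n ∣ sumℤ y
    moveAt-sum n∣x = subst (+ n ∣_) (sym sum-y)
      (∣m∣n⇒∣m+n (∣m∣n⇒∣m+n n∣x (wrapIf-≡-mod n (p ℕ.≟ 0) _)) (wrapIf-≡-mod n (p ℕ.≟ m) _))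
      where
      open ≡-Reasoning
      sum-y : sumℤ y ≡ sumℤ x + (a - (at x p + d)) + (b - (at x (suc p) - d))
      sum-y = begin
        sumℤ y                                                       ≡⟨ sumℤ-setAt (setAt x p a) (suc p) b (s≤s (s≤s p≤m)) ⟩
        sumℤ (setAt x p a) + (b - at (setAt x p a) (suc p))         ≡⟨ cong₂ (λ s c → s + (b - c)) (sumℤ-setAt x p a (s≤s (ℕP.m≤n⇒m≤1+n p≤m)))
                                                                          (at-setAt-≢ x p a (suc p) (ℕP.<⇒≢ (ℕP.n<1+n p))) ⟩
        sumℤ x + (a - at x p) + (b - at x (suc p))                  ≡⟨ ring (sumℤ x) a (at x p) b (at x (suc p)) d ⟩
        sumℤ x + (a - (at x p + d)) + (b - (at x (suc p) - d))      ∎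
        where
        ring : ∀ s a xp b xq d → s + (a - xp) + (b - xq) ≡ s + (a - (xp + d)) + (b - (xq - d))
        ring = solve-∀

    moveAt-left-≡ : p ≢ 0 → at y p ≡ at x p + d
    moveAt-left-≡ p≢0 = trans moveAt-left (wrapIf-≡ n (p ℕ.≟ 0) _ p≢0)

    moveAt-right-≡ : p ≢ m → at y (suc p) ≡ at x (suc p) - d
    moveAt-right-≡ p≢m = trans moveAt-right (wrapIf-≡ n (p ℕ.≟ m) _ p≢m)

    moveAt-left-≡-mod : at y p ≡ at x p + d [mod n ]
    moveAt-left-≡-mod = subst (λ z → z ≡ at x p + d [mod n ]) (sym moveAt-left) (wrapIf-≡-mod n (p ℕ.≟ 0) _)

    moveAt-right-≡-mod : at y (suc p) ≡ at x (suc p) - d [mod n ]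
    moveAt-right-≡-mod = subst (λ z → z ≡ at x (suc p) - d [mod n ]) (sym moveAt-right) (wrapIf-≡-mod n (p ℕ.≟ m) _)

    moveAt-valid : ∀ {S} → Valid S n m x → (p ≢ 0 → S (at x p + d)) → (p ≢ m → S (at x (suc p) - d)) →
                   Valid S n m y
    moveAt-valid {S} valid left-ok right-ok =
      mkValid {S = S} y first last middle (moveAt-sum (valid-sum S x valid))
      where
      first : IsResidue n (at y 0)
      first = from (p ℕ.≟ 0)
        where
        from : Dec (p ≡ 0) → IsResidue n (at y 0)
        from (yes p≡0) = subst (λ k → IsResidue n (at y k)) p≡0
                           (subst (IsResidue n) (sym moveAt-left) (wrapIf-residue n (p ℕ.≟ 0) _ p≡0))
        from (no  p≢0) = subst (IsResidue n) (sym (moveAt-elsewhere 0 (λ e → p≢0 (sym e)) (λ ())))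
                           (valid-first S x valid)
      last : IsResidue n (at y (suc m))
      last = from (p ℕ.≟ m)
        where
        from : Dec (p ≡ m) → IsResidue n (at y (suc m))
        from (yes p≡m) = subst (λ k → IsResidue n (at y (suc k))) p≡m
                           (subst (IsResidue n) (sym moveAt-right) (wrapIf-residue n (p ℕ.≟ m) _ p≡m))
        from (no  p≢m) = subst (IsResidue n)
                           (sym (moveAt-elsewhere (suc m) (λ e → ℕP.<⇒≢ (s≤s p≤m) (sym e))
                                                          (λ e → p≢m (sym (ℕP.suc-injective e)))))
                           (valid-last S x valid)
      middle : ∀ q → 1 ℕ.≤ q → q ℕ.≤ m → S (at y q)
      middle q 1≤q q≤m with q ℕ.≟ p | q ℕ.≟ suc p
      ... | yes refl | _        = subst S (sym (moveAt-left-≡ p≢0)) (left-ok p≢0)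
        where p≢0 = λ (e : q ≡ 0) → ℕP.<⇒≢ 1≤q (sym e)
      ... | no _     | yes refl = subst S (sym (moveAt-right-≡ p≢m)) (right-ok p≢m)
        where p≢m = ℕP.<⇒≢ q≤m
      ... | no q≢p   | no q≢p+1 =
        subst S (sym (moveAt-elsewhere q q≢p q≢p+1)) (valid-middle S x valid q 1≤q q≤m)

  moveAt-move⁺ : ∀ x {p} (p≤m : p ℕ.≤ m) → Move n m p (moveAt x p 1ℤ) x
  moveAt-move⁺ x {p} p≤m = record
    { left-end  = λ { refl → moveAt-left-≡-mod x p≤m 1ℤ }
    ; left      = moveAt-left-≡ x p≤m 1ℤ
    ; right     = moveAt-right-≡ x p≤m 1ℤ
    ; right-end = λ _ → moveAt-right-≡-mod x p≤m 1ℤ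
    ; elsewhere = λ q _ → moveAt-elsewhere x p≤m 1ℤ q
    }

  moveAt-move⁻ : ∀ x {p} (p≤m : p ℕ.≤ m) → Move n m p x (moveAt x p -1ℤ)
  moveAt-move⁻ x {p} p≤m = record
    { left-end  = λ { refl →
                    ≡-mod-shift {a = at (moveAt x 0 -1ℤ) 0} {at x 0} { -1ℤ} (moveAt-left-≡-mod x p≤m -1ℤ) }
    ; left      = λ p≢0 → shift-eq (moveAt-left-≡ x p≤m -1ℤ p≢0)
    ; right     = λ p≢m → shift-eq (moveAt-right-≡ x p≤m -1ℤ p≢m)
    ; right-end = λ _ →
                    ≡-mod-shift {a = at (moveAt x p -1ℤ) (suc p)} {at x (suc p)} {1ℤ} (moveAt-right-≡-mod x p≤m -1ℤ)
    ; elsewhere = λ q _ q≢p q≢p+1 → sym (moveAt-elsewhere x p≤m -1ℤ q q≢p q≢p+1)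
    }

module _ {n m : ℕ} {S : ℤ → Set} {c : ℤ} {x v : Vertex m}
         (valid-x : Valid S n m x) (valid-v : Valid S n m v)
         (winding : IsWinding n c x v) (cost≡0 : cost c (gap x v) m ≡ 0) where

  private
    load≡0 : ∀ k → k ℕ.≤ m → load c (gap x v) k ≡ 0ℤ
    load≡0 k k≤m = ℤP.∣i∣≡0⇒i≡0 (sumBelow≡0⇒ (suc m) cost≡0 k (s≤s k≤m))

    first-≡ : at x 0 ≡ at v 0
    first-≡ = ≡-mod⇒≡ (valid-first S x valid-x) (valid-first S v valid-v)
                (subst (+ n ∣_) (ring (at v 0) (at x 0))
                       (subst (λ c → c ≡ at v 0 - at x 0 [mod n ]) (load≡0 0 z≤n) winding))
      where
      ring : ∀ a b → 0ℤ - (a - b) ≡ b - a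
      ring = solve-∀

    middle-≡ : ∀ k → suc k ℕ.≤ m → at x (suc k) ≡ at v (suc k)
    middle-≡ k k<m = sym (ℤP.i-j≡0⇒i≡j _ _ (begin
      at v (suc k) - at x (suc k)                          ≡⟨ ℤP.+-identityˡ _ ⟨
      0ℤ + gap x v k                                   ≡⟨ cong (_+ gap x v k) (load≡0 k (ℕP.<⇒≤ k<m)) ⟨
      load c (gap x v) k + gap x v k               ≡⟨ load≡0 (suc k) k<m ⟩
      0ℤ                                                   ∎))
      where open ≡-Reasoning

    below-last : ∀ q → q ℕ.≤ m → at x q ≡ at v q
    below-last zero    _   = first-≡
    below-last (suc k) k<m = middle-≡ k k<m

    last-≡ : at x (suc m) ≡ at v (suc m)
    last-≡ = ≡-mod⇒≡ (valid-last S x valid-x) (valid-last S v valid-v)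
      (∣m+n∣m⇒∣n (subst (+ n ∣_) (sumℤ-except x v (suc m) ℕP.≤-refl agree) (valid-sum S x valid-x))
                 (valid-sum S v valid-v))
      where
      agree : ∀ j → j ℕ.< suc (suc m) → j ≢ suc m → at x j ≡ at v j
      agree j j<m+2 j≢m+1 = below-last j (ℕ.s≤s⁻¹ (ℕP.≤∧≢⇒< (ℕ.s≤s⁻¹ j<m+2) j≢m+1))

  cost≡0⇒≡ : x ≡ v
  cost≡0⇒≡ = at-ext x v λ q q<m+2 → case q ℕ.≟ suc m of λ where
    (yes refl) → last-≡
    (no  q≢m+1) → below-last q (ℕ.s≤s⁻¹ (ℕP.≤∧≢⇒< (ℕ.s≤s⁻¹ q<m+2) q≢m+1))

-- Realising a flow by a walk

module Upper (S : ℤ → Set) (lo hi : ℤ) (lo<hi : lo < hi)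
             (S-intro : ∀ {a} → lo ≤ a → a ≤ hi → S a) (S-bounds : ∀ {a} → S a → lo ≤ a × a ≤ hi)
             {n m : ℕ} {{_ : NonZero n}} {v : Vertex m} (valid-v : Valid S n m v) where

  bounds : ∀ x → Valid S n m x → ∀ j → 1 ℕ.≤ j → j ℕ.≤ m → lo ≤ at x j × at x j ≤ hi
  bounds x valid j 1≤j j≤m = S-bounds (valid-middle S x valid j 1≤j j≤m)

  S-suc : ∀ {a} → lo ≤ a → a < hi → S (a + 1ℤ)
  S-suc {a} lo≤a a<hi = S-intro (ℤP.≤-trans lo≤a (ℤP.i≤i+j a 1ℤ))
                                (subst (_≤ hi) (ℤP.+-comm 1ℤ a) (ℤP.i<j⇒suc[i]≤j a<hi))

  S-pred : ∀ {a} → lo < a → a ≤ hi → S (a - 1ℤ)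
  S-pred {a} lo<a a≤hi = S-intro (subst (lo ≤_) (ℤP.+-comm -1ℤ a) (ℤP.i<j⇒i≤pred[j] lo<a))
                                 (ℤP.≤-trans (ℤP.i-j≤i a 1ℤ) a≤hi)

  Descent : ℕ → Vertex m → Set
  Descent N x = ∃₂ λ y c → Adj S n m x y × IsWinding n c y v × cost c (gap y v) m ≡ N

  module _ {N : ℕ} {x : Vertex m} {c : ℤ} (valid-x : Valid S n m x) (winding : IsWinding n c x v)
           (cost≡ : cost c (gap x v) m ≡ suc N) {p : ℕ} (p≤m : p ℕ.≤ m) where

    descent⁺ : 0ℤ < load c (gap x v) p → (p ≢ 0 → at x p < hi) → (p ≢ m → lo < at x (suc p)) → Descent N x
    descent⁺ 0<load left right =
      y , c - δ p 0 , (valid-x , valid-y , _ , inj₂ (move⇒shift-at n m p≤m mv)) ,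
      winding-move⁻ n m mv {c} {v} winding , cost-move⁻-≡ n m mv {c} {v} p≤m 0<load cost≡
      where
      y = moveAt x p 1ℤ
      mv = moveAt-move⁺ x p≤m
      valid-y : Valid S n m y
      valid-y = moveAt-valid x p≤m 1ℤ {S} valid-x
        (λ p≢0 → S-suc (proj₁ (bounds x valid-x p (ℕP.n≢0⇒n>0 p≢0) p≤m)) (left p≢0))
        (λ p≢m → S-pred (right p≢m) (proj₂ (bounds x valid-x (suc p) (s≤s z≤n) (ℕP.≤∧≢⇒< p≤m p≢m))))

    descent⁻ : load c (gap x v) p < 0ℤ → (p ≢ 0 → lo < at x p) → (p ≢ m → at x (suc p) < hi) → Descent N x
    descent⁻ load<0 left right =
      y , c + δ p 0 , (valid-x , valid-y , _ , inj₁ (move⇒shift-at n m p≤m mv)) ,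
      winding-move n m mv {c} {v} winding , cost-move-≡ n m mv {c} {v} p≤m load<0 cost≡
      where
      y = moveAt x p -1ℤ
      mv = moveAt-move⁻ x p≤m
      valid-y : Valid S n m y
      valid-y = moveAt-valid x p≤m -1ℤ {S} valid-x
        (λ p≢0 → S-pred (left p≢0) (proj₂ (bounds x valid-x p (ℕP.n≢0⇒n>0 p≢0) p≤m)))
        (λ p≢m → S-suc (proj₁ (bounds x valid-x (suc p) (s≤s z≤n) (ℕP.≤∧≢⇒< p≤m p≢m))) (right p≢m))

  descent : ∀ {N x c} → Valid S n m x → IsWinding n c x v → cost c (gap x v) m ≡ suc N → Descent N x
  descent {N} {x} {c} valid-x winding cost≡
    with sumBelow≢0⇒ (suc m) (λ cost≡0 → ℕP.1+n≢0 (trans (sym cost≡) cost≡0))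
  ... | K , K≤m , load≢0 with ℤP.<-cmp 0ℤ (load c (gap x v) K)
  ... | tri≈ _ 0≡load _ = ⊥-elim (load≢0 (cong ∣_∣ (sym 0≡load)))
  ... | tri< 0<load _ _ =
    let p , 0<load′ , p≤m , left , right = Search.search m lo hi lo<hi (at x) (at v) (load c (gap x v))
                                              (bounds v valid-v) (λ _ → refl) K (ℕ.s≤s⁻¹ K≤m) 0<load
    in descent⁺ {N} {x} {c} valid-x winding cost≡ p≤m 0<load′ left right
  ... | tri> _ _ load<0 =
    let p , load′<0 , p≤m , left , right = Search⁻.search⁻ m lo hi lo<hi (at x) (at v) (load c (gap x v))
                                              (bounds v valid-v) (λ _ → refl) K (ℕ.s≤s⁻¹ K≤m) load<0
    in descent⁻ {N} {x} {c} valid-x winding cost≡ p≤m load′<0 left right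

  cost⇒walk : ∀ N x c → Valid S n m x → IsWinding n c x v → cost c (gap x v) m ≡ N → Walk S n m N x v
  cost⇒walk zero    x c valid-x winding cost≡0 = subst (λ x → Walk S n m 0 x v)
    (sym (cost≡0⇒≡ {S = S} {c} {x} {v} valid-x valid-v winding cost≡0)) here
  cost⇒walk (suc N) x c valid-x winding cost≡ with descent {N} {x} {c} valid-x winding cost≡
  ... | y , c' , adj , winding' , cost' = step {w = y} adj (cost⇒walk N y c' (proj₁ (proj₂ adj)) winding' cost')

  dist≤cost : ∀ {x c} → Valid S n m x → IsWinding n c x v → DistLe S n m x v (cost c (gap x v) m)
  dist≤cost {x} {c} valid-x winding = _ , ℕP.≤-refl , cost⇒walk _ x c valid-x winding refl

-- Reduction to trit profiles

least : ∀ {P : ℕ → Set} → (∀ e → Dec (P e)) → ∀ B → P B → ∃ λ d → P d × (∀ e → P e → d ℕ.≤ e)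
least {P} P? = <-rec (λ B → P B → Least) go
  where
  Least = ∃ λ d → P d × (∀ e → P e → d ℕ.≤ e)
  go : ∀ B → (∀ {e} → e ℕ.< B → P e → Least) → P B → Least
  go B smaller PB with ℕP.anyUpTo? P? B
  ... | yes (e , e<B , Pe) = smaller e<B Pe
  ... | no  none           = B , PB , λ e Pe → ℕP.≮⇒≥ (λ e<B → none (e , e<B , Pe))

∃-ball? : ∀ {P : ℤ → Set} → (∀ c → Dec (P c)) → ∀ e → Dec (∃ λ c → ∣ c ∣ ℕ.≤ e × P c)
∃-ball? {P} P? e =
  map′ to from (ℕP.anyUpTo? (λ k → P? (+ k)) (suc e) ⊎-dec ℕP.anyUpTo? (λ k → P? -[1+ k ]) e)
  where
  to : (∃ λ k → k ℕ.< suc e × P (+ k)) ⊎ (∃ λ k → k ℕ.< e × P -[1+ k ]) → ∃ λ c → ∣ c ∣ ℕ.≤ e × P c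
  to (inj₁ (k , k<1+e , Pk)) = + k , ℕ.s≤s⁻¹ k<1+e , Pk
  to (inj₂ (k , k<e , Pk))   = -[1+ k ] , k<e , Pk
  from : (∃ λ c → ∣ c ∣ ℕ.≤ e × P c) → (∃ λ k → k ℕ.< suc e × P (+ k)) ⊎ (∃ λ k → k ℕ.< e × P -[1+ k ])
  from (+ k      , k≤e , Pk) = inj₁ (k , s≤s k≤e , Pk)
  from (-[1+ k ] , k<e , Pk) = inj₂ (k , k<e , Pk)

data Tri : Set where
  minus nought plus : Tri

∀-Tri? : ∀ {P : Tri → Set} → (∀ t → Dec (P t)) → Dec (∀ t → P t)
∀-Tri? P? = map′ (λ { (p₋ , p₀ , p₊) → λ { minus → p₋ ; nought → p₀ ; plus → p₊ } })
                 (λ h → h minus , h nought , h plus)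
                 (P? minus ×-dec P? nought ×-dec P? plus)

∀-Vec? : ∀ {A : Set} → (∀ {P : A → Set} → (∀ a → Dec (P a)) → Dec (∀ a → P a)) →
         ∀ k {P : Vec A k → Set} → (∀ t → Dec (P t)) → Dec (∀ t → P t)
∀-Vec? ∀? zero    P? = map′ (λ { p [] → p }) (λ h → h []) (P? [])
∀-Vec? ∀? (suc k) P? =
  map′ (λ { h (a ∷ t) → h a t }) (λ h a t → h (a ∷ t)) (∀? λ a → ∀-Vec? ∀? k (λ t → P? (a ∷ t)))

triℤ : Tri → ℤ
triℤ minus  = -1ℤ
triℤ nought = 0ℤ
triℤ plus   = 1ℤ

low high : Tri → ℤ
low minus = 1ℤ
low _     = 0ℤ
high plus = 1ℤ
high _    = 0ℤ

high-low : ∀ t → high t - low t ≡ triℤ t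
high-low minus  = refl
high-low nought = refl
high-low plus   = refl

Trit-triℤ : ∀ t → Trit (triℤ t)
Trit-triℤ minus  = inj₁ refl
Trit-triℤ nought = inj₂ (inj₁ refl)
Trit-triℤ plus   = inj₂ (inj₂ refl)

Bit-low : ∀ t → Bit (low t)
Bit-low minus  = inj₂ refl
Bit-low nought = inj₁ refl
Bit-low plus   = inj₁ refl

Bit-high : ∀ t → Bit (high t)
Bit-high minus  = inj₁ refl
Bit-high nought = inj₁ refl
Bit-high plus   = inj₂ refl

bit-diff : ∀ {a b} → Bit a → Bit b → Trit (a - b)
bit-diff (inj₁ refl) (inj₁ refl) = inj₂ (inj₁ refl)
bit-diff (inj₁ refl) (inj₂ refl) = inj₁ refl
bit-diff (inj₂ refl) (inj₁ refl) = inj₂ (inj₂ refl)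
bit-diff (inj₂ refl) (inj₂ refl) = inj₂ (inj₁ refl)

Bit-intro : ∀ {a} → 0ℤ ≤ a → a ≤ 1ℤ → Bit a
Bit-intro {+ zero}          _ _ = inj₁ refl
Bit-intro {+ suc zero}      _ _ = inj₂ refl
Bit-intro {+ suc (suc _)}   _ (ℤ.+≤+ (s≤s ()))

Bit-bounds : ∀ {a} → Bit a → 0ℤ ≤ a × a ≤ 1ℤ
Bit-bounds (inj₁ refl) = ℤ.+≤+ z≤n , ℤ.+≤+ z≤n
Bit-bounds (inj₂ refl) = ℤ.+≤+ z≤n , ℤ.+≤+ (s≤s z≤n)

Trit-intro : ∀ {a} → -1ℤ ≤ a → a ≤ 1ℤ → Trit a
Trit-intro {+ zero}          _ _ = inj₂ (inj₁ refl)
Trit-intro {+ suc zero}      _ _ = inj₂ (inj₂ refl)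
Trit-intro {+ suc (suc _)}   _ (ℤ.+≤+ (s≤s ()))
Trit-intro { -[1+ zero ]}    _ _ = inj₁ refl
Trit-intro { -[1+ suc _ ]}   (ℤ.-≤- ()) _

Trit-bounds : ∀ {a} → Trit a → -1ℤ ≤ a × a ≤ 1ℤ
Trit-bounds (inj₁ refl)        = ℤ.-≤- z≤n , ℤ.-≤+
Trit-bounds (inj₂ (inj₁ refl)) = ℤ.-≤+ , ℤ.+≤+ z≤n
Trit-bounds (inj₂ (inj₂ refl)) = ℤ.-≤+ , ℤ.+≤+ (s≤s z≤n)

classify : ℤ → Tri
classify -[1+ _ ] = minus
classify (+ zero) = nought
classify (+ suc _) = plus

triℤ-classify : ∀ {a} → Trit a → triℤ (classify a) ≡ a
triℤ-classify (inj₁ refl)        = refl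
triℤ-classify (inj₂ (inj₁ refl)) = refl
triℤ-classify (inj₂ (inj₂ refl)) = refl

profile : ∀ {k} → Vec Tri k → ℕ → ℤ
profile t = at (map triℤ t)

∣profile∣≤1 : ∀ {k} (t : Vec Tri k) j → ∣ profile t j ∣ ℕ.≤ 1
∣profile∣≤1 []             _       = z≤n
∣profile∣≤1 (minus  ∷ _)   zero    = ℕP.≤-refl
∣profile∣≤1 (nought ∷ _)   zero    = z≤n
∣profile∣≤1 (plus   ∷ _)   zero    = ℕP.≤-refl
∣profile∣≤1 (_      ∷ t)   (suc j) = ∣profile∣≤1 t j

classifyAll : ∀ k → (ℕ → ℤ) → Vec Tri k
classifyAll zero    _ = []
classifyAll (suc k) D = classify (D 0) ∷ classifyAll k (λ j → D (suc j))

profile-classifyAll : ∀ k D → (∀ j → j ℕ.< k → Trit (D j)) →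
                      ∀ j → j ℕ.< k → profile (classifyAll k D) j ≡ D j
profile-classifyAll (suc k) D trit zero    _        = triℤ-classify (trit 0 (s≤s z≤n))
profile-classifyAll (suc k) D trit (suc j) (s≤s j<k) =
  profile-classifyAll k (λ j → D (suc j)) (λ j j<k → trit (suc j) (s≤s j<k)) j j<k

at-map-high-low : ∀ {k} (t : Vec Tri k) j → at (map high t) j - at (map low t) j ≡ profile t j
at-map-high-low []      _       = refl
at-map-high-low (a ∷ _) zero    = high-low a
at-map-high-low (_ ∷ t) (suc j) = at-map-high-low t j

module _ (n m : ℕ) where

  -- The bound on ∣ c ∣ follows from the bound on the cost; it is stated to make CostBound decidable.
  CostBound : ℕ → Vec Tri m → ℕ → Set
  CostBound e t r = ∃ λ c → ∣ c ∣ ℕ.≤ e × c ≡ + r [mod n ] × cost c (profile t) m ℕ.≤ e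

  AllBounded : ℕ → Set
  AllBounded e = ∀ t {r} → r ℕ.< n → CostBound e t r

  allBounded? : ∀ e → Dec (AllBounded e)
  allBounded? e = ∀-Vec? ∀-Tri? m λ t → ℕP.allUpTo? (λ r → ∃-ball? (λ c →
    (+ n ∣? (c - + r)) ×-dec (cost c (profile t) m ℕ.≤? e)) e) n

  allBounded-crude : AllBounded (suc m ℕ.* (n ℕ.+ m))
  allBounded-crude t {r} r<n = + r , ℕP.≤-trans (ℕP.<⇒≤ r<n) n≤B , ≡⇒≡-mod {n} {+ r} refl ,
    sumBelow-≤-* _ (suc m) (n ℕ.+ m) λ k k≤m →
      ℕP.≤-trans (∣load∣≤ (+ r) (profile t) k (∣profile∣≤1 t)) (ℕP.+-mono-≤ (ℕP.<⇒≤ r<n) (ℕ.s≤s⁻¹ k≤m))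
    where
    n≤B : n ℕ.≤ suc m ℕ.* (n ℕ.+ m)
    n≤B = ℕP.≤-trans (ℕP.m≤m+n n m) (ℕP.m≤n*m (n ℕ.+ m) (suc m))

  walk⇒costBound : ∀ {S k e x v t r} → Walk S n m k x v → k ℕ.≤ e → at v 0 - at x 0 ≡ + r →
                   (∀ j → j ℕ.< m → gap x v j ≡ profile t j) → CostBound e t r
  walk⇒costBound {e = e} {x} {v} {t} walk k≤e v₀-x₀≡r gap≡ with walk⇒cost n m walk
  ... | c , winding , cost≤k = c , ℕP.≤-trans (∣c∣≤cost c (profile t) m) cost≤e ,
                               subst (λ z → c ≡ z [mod n ]) v₀-x₀≡r winding , cost≤e
    where
    cost≤e : cost c (profile t) m ℕ.≤ e
    cost≤e = subst (ℕ._≤ e) (cost-cong c m gap≡) (ℕP.≤-trans cost≤k k≤e)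

weaken : ∀ {S n m x v a b} → DistLe S n m x v a → a ℕ.≤ b → DistLe S n m x v b
weaken (k , k≤a , walk) a≤b = k , ℕP.≤-trans k≤a a≤b , walk

module _ {n m : ℕ} {{_ : NonZero n}} (S : ℤ → Set) (lo hi : ℤ) (lo<hi : lo < hi)
         (S-intro : ∀ {a} → lo ≤ a → a ≤ hi → S a) (S-bounds : ∀ {a} → S a → lo ≤ a × a ≤ hi) where

  costBound⇒dist : ∀ {e x v} → AllBounded n m e → Valid S n m x → Valid S n m v →
                   (∀ j → j ℕ.< m → Trit (gap x v j)) → DistLe S n m x v e
  costBound⇒dist {e} {x} {v} bounded valid-x valid-v trit
    with bounded (classifyAll m (gap x v)) (n%ℕd<d (at v 0 - at x 0) n)
  ... | c , _ , c≡r , cost≤e =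
    weaken (Upper.dist≤cost S lo hi lo<hi S-intro S-bounds valid-v valid-x winding)
           (subst (ℕ._≤ e) (cost-cong c m (profile-classifyAll m (gap x v) trit)) cost≤e)
    where
    winding : IsWinding n c x v
    winding = ≡-mod-trans {n} {c} {wrap n (at v 0 - at x 0)} c≡r (wrap≡ n (at v 0 - at x 0))

module _ (n m : ℕ) {{_ : NonZero n}} where

  mkVertex : ℤ → Vec ℤ m → Vertex m
  mkVertex a mid = a ∷ (mid ∷ʳ wrap n (- (a + sumℤ mid)))

  mkVertex-valid : ∀ {S a} mid → IsResidue n a → (∀ j → j ℕ.< m → S (at mid j)) → Valid S n m (mkVertex a mid)
  mkVertex-valid {S} {a} mid a-residue mid∈S = mkValid {S = S} (mkVertex a mid) a-residue last middle n∣sum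
    where
    w = wrap n (- (a + sumℤ mid))
    last : IsResidue n (at (mkVertex a mid) (suc m))
    last = subst (IsResidue n) (sym (at-∷ʳ-last mid w)) (wrap-residue n (- (a + sumℤ mid)))
    middle : ∀ q → 1 ℕ.≤ q → q ℕ.≤ m → S (at (mkVertex a mid) q)
    middle (suc j) _ j<m = subst S (sym (at-∷ʳ mid w j j<m)) (mid∈S j j<m)
    n∣sum : + n ∣ sumℤ (mkVertex a mid)
    n∣sum = subst (+ n ∣_) (trans (ring a (sumℤ mid) w) (cong (_+_ a) (sym (sumℤ-∷ʳ mid w))))
                  (wrap≡ n (- (a + sumℤ mid)))
      where
      ring : ∀ a s w → w - - (a + s) ≡ a + (s + w)
      ring = solve-∀

  gap-mkVertex : ∀ a b mid mid' j → j ℕ.< m → gap (mkVertex a mid) (mkVertex b mid') j ≡ at mid' j - at mid j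
  gap-mkVertex a b mid mid' j j<m = cong₂ _-_ (at-∷ʳ mid' _ j j<m) (at-∷ʳ mid _ j j<m)

module _ (n m : ℕ) {{_ : NonZero n}} where

  0-residue : IsResidue n 0ℤ
  0-residue = <⇒IsResidue (ℕ.>-nonZero⁻¹ n)

  zeroV-valid : Valid Trit n m (zeroV m)
  zeroV-valid = mkValid {S = Trit} (zeroV m) 0-residue
    (subst (IsResidue n) (sym (at-replicate (suc (suc m)) (suc m))) 0-residue)
    (λ q _ _ → subst Trit (sym (at-replicate (suc (suc m)) q)) (inj₂ (inj₁ refl)))
    (subst (+ n ∣_) (sym (sumℤ-replicate (suc (suc m)))) (≡⇒≡-mod {n} {0ℤ} refl))

  diam-upper : ∀ {e} → AllBounded n m e → ∀ u v → Valid Bit n m u → Valid Bit n m v → DistLe Bit n m u v e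
  diam-upper bounded u v valid-u valid-v =
    costBound⇒dist Bit 0ℤ 1ℤ (ℤ.+<+ (s≤s z≤n)) Bit-intro Bit-bounds {x = u} {v} bounded valid-u valid-v λ j j<m →
      bit-diff (valid-middle Bit v valid-v (suc j) (s≤s z≤n) j<m) (valid-middle Bit u valid-u (suc j) (s≤s z≤n) j<m)

  ecc-upper : ∀ {e} → AllBounded n m e → ∀ w → Valid Trit n m w → DistLe Trit n m (zeroV m) w e
  ecc-upper bounded w valid-w =
    costBound⇒dist Trit -1ℤ 1ℤ ℤ.-<+ Trit-intro Trit-bounds {x = zeroV m} {w} bounded zeroV-valid valid-w λ j j<m →
      subst Trit (sym (gap-zero j)) (valid-middle Trit w valid-w (suc j) (s≤s z≤n) j<m)
    where
    gap-zero : ∀ j → gap (zeroV m) w j ≡ at w (suc j)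
    gap-zero j = trans (cong (_-_ (at w (suc j))) (at-replicate (suc (suc m)) (suc j))) (ℤP.+-identityʳ _)

  diam-lower : ∀ {e} → (∀ u v → Valid Bit n m u → Valid Bit n m v → DistLe Bit n m u v e) → AllBounded n m e
  diam-lower {e} dist≤e t {r} r<n = from-dist (dist≤e u v valid-u valid-v)
    where
    u = mkVertex n m 0ℤ (map low t)
    v = mkVertex n m (+ r) (map high t)
    valid-u : Valid Bit n m u
    valid-u = mkVertex-valid n m {S = Bit} (map low t) 0-residue (at-map-∈ {P = Bit} low Bit-low t)
    valid-v : Valid Bit n m v
    valid-v = mkVertex-valid n m {S = Bit} (map high t) (<⇒IsResidue r<n) (at-map-∈ {P = Bit} high Bit-high t)
    from-dist : DistLe Bit n m u v e → CostBound n m e t r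
    from-dist (k , k≤e , walk) = walk⇒costBound n m {t = t} walk k≤e (ℤP.+-identityʳ (+ r)) λ j j<m →
      trans (gap-mkVertex n m 0ℤ (+ r) (map low t) (map high t) j j<m) (at-map-high-low t j)

  ecc-lower : ∀ {e} → (∀ w → Valid Trit n m w → DistLe Trit n m (zeroV m) w e) → AllBounded n m e
  ecc-lower {e} dist≤e t {r} r<n = from-dist (dist≤e w valid-w)
    where
    w = mkVertex n m (+ r) (map triℤ t)
    valid-w : Valid Trit n m w
    valid-w = mkVertex-valid n m {S = Trit} (map triℤ t) (<⇒IsResidue r<n) (at-map-∈ {P = Trit} triℤ Trit-triℤ t)
    from-dist : DistLe Trit n m (zeroV m) w e → CostBound n m e t r
    from-dist (k , k≤e , walk) = walk⇒costBound n m {t = t} walk k≤e (ℤP.+-identityʳ (+ r)) λ j j<m →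
      trans (cong₂ _-_ (at-∷ʳ (map triℤ t) _ j j<m) (at-replicate (suc (suc m)) (suc j))) (ℤP.+-identityʳ _)

theorem5p22 : (n m : ℕ) → 1 ℕ.≤ n →
    Σ ℕ (λ d → IsDiam Bit n m d × IsEcc Trit n m (zeroV m) d)
theorem5p22 zero    _ ()
theorem5p22 (suc n) m _ =
  let d , bounded , minimal = least (allBounded? (suc n) m) _ (allBounded-crude (suc n) m)
  in d , (diam-upper (suc n) m bounded , λ d' dist≤d' → minimal d' (diam-lower (suc n) m dist≤d'))
       , (ecc-upper (suc n) m bounded , λ e' dist≤e' → minimal e' (ecc-lower (suc n) m dist≤e'))
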